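{- Let $n,s\ge 1$ and let $x=(P,w^1,\ldots,w^s)\le y=(P'',w^{1\prime\prime},\ldots,w^{s\prime\prime})$ be elements of $\Pi_{n,s+1}$ with $x\neq\hat 0$. Then the interval $[x,y]$ in $\Pi_{n,s+1}$ is isomorphic, as a poset, to the interval $[P,P'']$ in the partition lattice $\Pi_n$; an isomorphism is given by $(P',w^{1\prime},\ldots,w^{s\prime})\mapsto P'$.
   Context: A vector partition of $[n]=\{1,\ldots,n\}$ into $s+1$ components is a tuple $(P,w^1,\ldots,w^s)$ where $P$ is a set partition of $[n]$ and each $w^i$ assigns to every part $B$ of $P$ a label $w^i(B)\subseteq[n]$ with $|w^i(B)|=|B|$, such that $\{w^i(B):B\in P\}$ is a partition of $[n]$ (the $i$-th label of $B$). The poset $\Pi_{n,s+1}$ consists of all such tuples together with an added least element $\hat 0$, ordered by $(P,w^1,\ldots,w^s)\le(P',w^{1\prime},\ldots,w^{s\prime})$ iff every part $B'$ of $P'$ is a union of parts of $P$ and, for each $i$, $w^{i\prime}(B')$ is the union of the labels $w^i(B)$ over the parts $B\subseteq B'$ of $P$. $\Pi_n$ denotes the lattice of set partitions of $[n]$, with $P\le P'$ iff every part of $P'$ is a union of parts of $P$. -}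

module Defs where

open import Data.Nat using (ℕ; _≤_)
open import Data.Bool using (Bool; true)
open import Data.Fin using (Fin)
open import Data.Fin.Subset using (Subset; _∈_; _⊆_; ∣_∣)
open import Data.Maybe using (Maybe; just; nothing)
open import Data.Product using (Σ; ∃-syntax; _×_; _,_; proj₁; proj₂)
open import Data.Empty using (⊥)
open import Data.Unit using (⊤)
open import Function.Bundles using (_⇔_)
open import Relation.Binary.PropositionalEquality using (_≡_)

record Partition (n : ℕ) : Set where
  field
    isBlock  : Subset n → Bool
    nonempty : ∀ B → isBlock B ≡ true → ∃[ m ] m ∈ B
    cover    : ∀ m → ∃[ B ] (isBlock B ≡ true × m ∈ B)
    disjoint : ∀ B C → isBlock B ≡ true → isBlock C ≡ true →
               ∀ m → m ∈ B → m ∈ C → B ≡ C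
open Partition public

Block : ∀ {n} → Partition n → Subset n → Set
Block P B = isBlock P B ≡ true

_≈P_ : ∀ {n} → Partition n → Partition n → Set
P ≈P Q = ∀ B → isBlock P B ≡ isBlock Q B

-- P ≤ Q in Π_n: every block of Q is a union of blocks of P
_≤P_ : ∀ {n} → Partition n → Partition n → Set
P ≤P Q = ∀ B' → Block Q B' → ∀ m → m ∈ B' → ∃[ B ] (Block P B × B ⊆ B' × m ∈ B)

-- Vector partitions of [n] into s+1 components: (P, w¹, …, wˢ)

record VecPartition (n s : ℕ) : Set where
  field
    part     : Partition n
    -- lab i B is the (i+1)-th label w^i(B); only meaningful on blocks B of part
    lab      : Fin s → Subset n → Subset n
    lab-size : ∀ i B → Block part B → ∣ lab i B ∣ ≡ ∣ B ∣
    lab-cover    : ∀ i m → ∃[ B ] (Block part B × m ∈ lab i B)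
    lab-disjoint : ∀ i B C → Block part B → Block part C →
                   ∀ m → m ∈ lab i B → m ∈ lab i C → B ≡ C
open VecPartition public

_≈V_ : ∀ {n s} → VecPartition n s → VecPartition n s → Set
x ≈V y = (part x ≈P part y) ×
         (∀ i B → Block (part x) B → lab x i B ≡ lab y i B)

_≤V_ : ∀ {n s} → VecPartition n s → VecPartition n s → Set
x ≤V y = (part x ≤P part y) ×
         (∀ i B' → Block (part y) B' → ∀ m →
            (m ∈ lab y i B') ⇔ (∃[ B ] (Block (part x) B × B ⊆ B' × m ∈ lab x i B)))

-- The poset Π_{n,s+1}: vector partitions with an added least element 0̂ = nothing

Π : ℕ → ℕ → Set
Π n s = Maybe (VecPartition n s)

_≤Π_ : ∀ {n s} → Π n s → Π n s → Set
nothing ≤Π _      = ⊤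
just _  ≤Π nothing = ⊥
just x  ≤Π just y  = x ≤V y

_≈Π_ : ∀ {n s} → Π n s → Π n s → Set
nothing ≈Π nothing = ⊤
nothing ≈Π just _  = ⊥
just _  ≈Π nothing = ⊥
just x  ≈Π just y  = x ≈V y

IntervalΠ : ∀ {n s} → Π n s → Π n s → Set
IntervalΠ {n} {s} a b = Σ (Π n s) (λ z → a ≤Π z × z ≤Π b)

IntervalP : ∀ {n} → Partition n → Partition n → Set
IntervalP {n} P Q = Σ (Partition n) (λ R → P ≤P R × R ≤P Q)

forget : ∀ {n s} (x y : VecPartition n s) →
         IntervalΠ (just x) (just y) → IntervalP (part x) (part y)
forget x y (nothing , () , _)
forget x y (just z , p , q) = part z , proj₁ p , proj₁ q

record IsOrderIso {A B : Set}
  (_≈A_ : A → A → Set) (_≤A_ : A → A → Set)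
  (_≈B_ : B → B → Set) (_≤B_ : B → B → Set)
  (f : A → B) : Set where
  field
    cong       : ∀ a a' → a ≈A a' → f a ≈B f a'
    injective  : ∀ a a' → f a ≈B f a' → a ≈A a'
    surjective : ∀ b → ∃[ a ] (f a ≈B b)
    order      : ∀ a a' → (a ≤A a') ⇔ (f a ≤B f a')

_≈IΠ_ : ∀ {n s} {a b : Π n s} → IntervalΠ a b → IntervalΠ a b → Set
u ≈IΠ v = proj₁ u ≈Π proj₁ v

_≤IΠ_ : ∀ {n s} {a b : Π n s} → IntervalΠ a b → IntervalΠ a b → Set
u ≤IΠ v = proj₁ u ≤Π proj₁ v

_≈IP_ : ∀ {n} {P Q : Partition n} → IntervalP P Q → IntervalP P Q → Set
u ≈IP v = proj₁ u ≈P proj₁ v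

_≤IP_ : ∀ {n} {P Q : Partition n} → IntervalP P Q → IntervalP P Q → Set
u ≤IP v = proj₁ u ≤P proj₁ v

-- Above a vector partition x ≠ 0̂ the labels are forced: if x ≤ z, then the i-th label of a block
-- C of z is the union of the i-th labels of the blocks of x inside C, i.e. the set of m whose
-- "i-th label block" (the block of x whose i-th label contains m) lies in C.  Hence z is
-- determined by its partition, and z ≤ z' exactly when part z ≤ part z'.  Conversely every
-- partition R between part x and part y carries this induced labelling, which is a genuine vector
-- partition lying in [x, y].  The only non-formal point is the size condition: the maps sending m
-- to its i-th label block and to its block have fibres of the same size |B| over every block B,
-- so they send equally many points into any block C of R, and the second map sends |C| points.

module Submission where

open import Data.Bool using (Bool; true; false) renaming (_≟_ to _≟ᵇ_)
open import Data.Fin using (Fin; zero; suc)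
open import Data.Fin.Subset using (Subset; _∈_; _⊆_; ∣_∣)
open import Data.Fin.Subset.Properties using (_⊆?_; ⊆-refl; ⊆-trans; ⊆-antisym)
open import Data.Maybe using (just; nothing)
open import Data.Nat using (ℕ; zero; suc; _+_; _*_; _≤_)
open import Data.Nat.Properties using (+-identityʳ; *-distribʳ-+; +-commutativeSemigroup)
import Algebra.Properties.CommutativeSemigroup as CommutativeSemigroupProperties
open import Data.Product using (∃-syntax; _×_; _,_; proj₁; proj₂)
open import Data.Vec using ([]; _∷_; tabulate)
open import Data.Vec.Properties using (≡-dec; []=⇒lookup; lookup⇒[]=; lookup∘tabulate)
open import Defs
open import Function using (_∘_)
open import Function.Bundles using (_⇔_; mk⇔; Equivalence)
open import Level using (Level)
open import Relation.Binary using (DecidableEquality)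
open import Relation.Binary.PropositionalEquality
open import Relation.Nullary using (yes; no; does; contradiction)
open import Relation.Nullary.Decidable using (dec-true)
open import Relation.Unary using (Pred; Decidable)

open CommutativeSemigroupProperties +-commutativeSemigroup using (interchange)

private variable
  ℓ : Level
  k n : ℕ

_≟_ : DecidableEquality (Subset n)
_≟_ = ≡-dec _≟ᵇ_

𝟙 : Bool → ℕ
𝟙 true  = 1
𝟙 false = 0

satisfying : {P : Pred (Fin n) ℓ} → Decidable P → Subset n
satisfying P? = tabulate (λ m → does (P? m))

module _ {P : Pred (Fin n) ℓ} (P? : Decidable P) where

  ∈-satisfying⁺ : ∀ {m} → P m → m ∈ satisfying P?
  ∈-satisfying⁺ {m} p = lookup⇒[]= m _ (trans (lookup∘tabulate _ m) (dec-true (P? m) p))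

  ∈-satisfying⁻ : ∀ {m} → m ∈ satisfying P? → P m
  ∈-satisfying⁻ {m} m∈ with P? m | trans (sym (lookup∘tabulate (does ∘ P?) m)) ([]=⇒lookup m∈)
  ... | yes p | _ = p
  ... | no _  | ()

∣∷∣ : ∀ b (p : Subset n) → ∣ b ∷ p ∣ ≡ 𝟙 b + ∣ p ∣
∣∷∣ true  p = refl
∣∷∣ false p = refl

∑ₛ : (Subset k → ℕ) → ℕ
∑ₛ {zero}  G = G []
∑ₛ {suc k} G = ∑ₛ (λ a → G (true ∷ a)) + ∑ₛ (λ a → G (false ∷ a))

∑ₛ-cong : {G H : Subset k → ℕ} → (∀ a → G a ≡ H a) → ∑ₛ G ≡ ∑ₛ H
∑ₛ-cong {zero}  G≗H = G≗H []
∑ₛ-cong {suc k} G≗H =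
  cong₂ _+_ (∑ₛ-cong (λ a → G≗H (true ∷ a))) (∑ₛ-cong (λ a → G≗H (false ∷ a)))

∑ₛ-zero : ∑ₛ {k} (λ _ → 0) ≡ 0
∑ₛ-zero {zero}  = refl
∑ₛ-zero {suc k} = cong₂ _+_ (∑ₛ-zero {k}) (∑ₛ-zero {k})

∑ₛ-distrib-+ : (G H : Subset k → ℕ) → ∑ₛ (λ a → G a + H a) ≡ ∑ₛ G + ∑ₛ H
∑ₛ-distrib-+ {zero}  G H = refl
∑ₛ-distrib-+ {suc k} G H = trans
  (cong₂ _+_ (∑ₛ-distrib-+ (λ a → G (true ∷ a)) (λ a → H (true ∷ a)))
             (∑ₛ-distrib-+ (λ a → G (false ∷ a)) (λ a → H (false ∷ a))))
  (interchange (∑ₛ (λ a → G (true ∷ a))) (∑ₛ (λ a → H (true ∷ a)))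
               (∑ₛ (λ a → G (false ∷ a))) (∑ₛ (λ a → H (false ∷ a))))

∑ₛ-𝟙≡ : (G : Subset k → ℕ) (b : Subset k) → ∑ₛ (λ a → 𝟙 (does (b ≟ a)) * G a) ≡ G b
∑ₛ-𝟙≡ {zero}  G []          = +-identityʳ (G [])
∑ₛ-𝟙≡ {suc k} G (true ∷ b)  = trans (cong₂ _+_ (∑ₛ-𝟙≡ _ b) (∑ₛ-zero {k})) (+-identityʳ _)
∑ₛ-𝟙≡ {suc k} G (false ∷ b) = cong₂ _+_ (∑ₛ-zero {k}) (∑ₛ-𝟙≡ _ b)

preimage : {Q : Pred (Subset k) ℓ} → (Fin n → Subset k) → Decidable Q → Subset n
preimage f Q? = satisfying (λ m → Q? (f m))

fibre : (Fin n → Subset k) → Subset k → Subset n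
fibre f a = preimage f (_≟ a)

∣preimage∣≡∑ₛ-fibres : {Q : Pred (Subset k) ℓ} (f : Fin n → Subset k) (Q? : Decidable Q) →
                      ∣ preimage f Q? ∣ ≡ ∑ₛ (λ a → ∣ fibre f a ∣ * 𝟙 (does (Q? a)))
∣preimage∣≡∑ₛ-fibres {k = k} {n = zero}  f Q? = sym (∑ₛ-zero {k})
∣preimage∣≡∑ₛ-fibres {k = k} {n = suc n} f Q? = begin
  ∣ preimage f Q? ∣
    ≡⟨ ∣∷∣ _ (preimage (f ∘ suc) Q?) ⟩
  𝟙 (does (Q? (f zero))) + ∣ preimage (f ∘ suc) Q? ∣
    ≡⟨ cong₂ _+_ (sym (∑ₛ-𝟙≡ (λ a → 𝟙 (does (Q? a))) (f zero)))
                 (∣preimage∣≡∑ₛ-fibres (f ∘ suc) Q?) ⟩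
  ∑ₛ (λ a → 𝟙 (does (f zero ≟ a)) * 𝟙 (does (Q? a))) +
  ∑ₛ (λ a → ∣ fibre (f ∘ suc) a ∣ * 𝟙 (does (Q? a)))
    ≡⟨ sym (∑ₛ-distrib-+ {k} _ _) ⟩
  ∑ₛ (λ a → 𝟙 (does (f zero ≟ a)) * 𝟙 (does (Q? a)) + ∣ fibre (f ∘ suc) a ∣ * 𝟙 (does (Q? a)))
    ≡⟨ ∑ₛ-cong {k} (λ a →
         sym (*-distribʳ-+ (𝟙 (does (Q? a))) (𝟙 (does (f zero ≟ a))) ∣ fibre (f ∘ suc) a ∣)) ⟩
  ∑ₛ (λ a → (𝟙 (does (f zero ≟ a)) + ∣ fibre (f ∘ suc) a ∣) * 𝟙 (does (Q? a)))
    ≡⟨ ∑ₛ-cong {k} (λ a →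
         cong (_* 𝟙 (does (Q? a))) (sym (∣∷∣ (does (f zero ≟ a)) (fibre (f ∘ suc) a)))) ⟩
  ∑ₛ (λ a → ∣ fibre f a ∣ * 𝟙 (does (Q? a)))
    ∎
  where open ≡-Reasoning

∣preimage∣-cong-fibres : {Q : Pred (Subset k) ℓ} (f g : Fin n → Subset k) →
                         (∀ a → ∣ fibre f a ∣ ≡ ∣ fibre g a ∣) →
                         (Q? : Decidable Q) → ∣ preimage f Q? ∣ ≡ ∣ preimage g Q? ∣
∣preimage∣-cong-fibres f g f≈g Q? = begin
  ∣ preimage f Q? ∣                              ≡⟨ ∣preimage∣≡∑ₛ-fibres f Q? ⟩
  ∑ₛ (λ a → ∣ fibre f a ∣ * 𝟙 (does (Q? a)))     ≡⟨ ∑ₛ-cong (λ a → cong (_* 𝟙 (does (Q? a))) (f≈g a)) ⟩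
  ∑ₛ (λ a → ∣ fibre g a ∣ * 𝟙 (does (Q? a)))     ≡⟨ ∣preimage∣≡∑ₛ-fibres g Q? ⟨
  ∣ preimage g Q? ∣                              ∎
  where open ≡-Reasoning

module _ {n : ℕ} where

  ≤P-refl : {P : Partition n} → P ≤P P
  ≤P-refl B bB m m∈B = B , bB , ⊆-refl , m∈B

  blockOf : Partition n → Fin n → Subset n
  blockOf P m = proj₁ (cover P m)

  blockOf-isBlock : ∀ (P : Partition n) m → Block P (blockOf P m)
  blockOf-isBlock P m = proj₁ (proj₂ (cover P m))

  ∈-blockOf : ∀ (P : Partition n) m → m ∈ blockOf P m
  ∈-blockOf P m = proj₂ (proj₂ (cover P m))

  blocks-above-unique : ∀ {P R : Partition n} {B C D} → Block P B → Block R C → Block R D →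
                        B ⊆ C → B ⊆ D → C ≡ D
  blocks-above-unique {P = P} {R = R} {B} bB bC bD B⊆C B⊆D with nonempty P B bB
  ... | e , e∈B = disjoint R _ _ bC bD e (B⊆C e∈B) (B⊆D e∈B)

  module _ {P R : Partition n} (P≤R : P ≤P R) where

    block-above : ∀ {B} → Block P B → ∃[ C ] (Block R C × B ⊆ C)
    block-above {B} bB with nonempty P B bB
    ... | e , e∈B with cover R e
    ... | C , bC , e∈C with P≤R C bC e e∈C
    ... | B₀ , bB₀ , B₀⊆C , e∈B₀ with disjoint P B B₀ bB bB₀ e e∈B e∈B₀
    ... | refl = C , bC , B₀⊆C

    meeting-block-⊆ : ∀ {B C e} → Block P B → Block R C → e ∈ B → e ∈ C → B ⊆ C
    meeting-block-⊆ {B} {C} {e} bB bC e∈B e∈C with block-above bB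
    ... | D , bD , B⊆D with disjoint R C D bC bD e e∈C (B⊆D e∈B)
    ... | refl = B⊆D

    preimage-blockOf-⊆ : ∀ {C} → Block R C → preimage (blockOf P) (_⊆? C) ≡ C
    preimage-blockOf-⊆ {C} bC = ⊆-antisym
      (λ {m} m∈ → ∈-satisfying⁻ (λ m → blockOf P m ⊆? C) m∈ (∈-blockOf P m))
      (λ {m} m∈C → ∈-satisfying⁺ (λ m → blockOf P m ⊆? C)
                     (meeting-block-⊆ (blockOf-isBlock P m) bC (∈-blockOf P m) m∈C))

  fibre-blockOf : ∀ {P : Partition n} {B} → Block P B → fibre (blockOf P) B ≡ B
  fibre-blockOf {P} {B} bB = ⊆-antisym
    (λ {m} m∈ → subst (m ∈_) (∈-satisfying⁻ (λ m → blockOf P m ≟ B) m∈) (∈-blockOf P m))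
    (λ {m} m∈B → ∈-satisfying⁺ (λ m → blockOf P m ≟ B)
                   (disjoint P _ _ (blockOf-isBlock P m) bB m (∈-blockOf P m) m∈B))

module InducedLabels {n s : ℕ} (x : VecPartition n s) where

  private P = part x

  labelBlock : Fin s → Fin n → Subset n
  labelBlock i m = proj₁ (lab-cover x i m)

  labelBlock-isBlock : ∀ i m → Block P (labelBlock i m)
  labelBlock-isBlock i m = proj₁ (proj₂ (lab-cover x i m))

  ∈-lab-labelBlock : ∀ i m → m ∈ lab x i (labelBlock i m)
  ∈-lab-labelBlock i m = proj₂ (proj₂ (lab-cover x i m))

  labelBlock-unique : ∀ {i m B} → Block P B → m ∈ lab x i B → labelBlock i m ≡ B
  labelBlock-unique {i} {m} bB m∈ =
    lab-disjoint x i _ _ (labelBlock-isBlock i m) bB m (∈-lab-labelBlock i m) m∈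

  ∣fibre-labelBlock∣ : ∀ i B → ∣ fibre (labelBlock i) B ∣ ≡ ∣ fibre (blockOf P) B ∣
  ∣fibre-labelBlock∣ i B with isBlock P B ≟ᵇ true
  ... | yes bB = begin
    ∣ fibre (labelBlock i) B ∣    ≡⟨ cong ∣_∣ fibre≡lab ⟩
    ∣ lab x i B ∣                 ≡⟨ lab-size x i B bB ⟩
    ∣ B ∣                         ≡⟨ cong ∣_∣ (fibre-blockOf {P = P} bB) ⟨
    ∣ fibre (blockOf P) B ∣       ∎
    where
    open ≡-Reasoning
    fibre≡lab : fibre (labelBlock i) B ≡ lab x i B
    fibre≡lab = ⊆-antisym
      (λ {m} m∈ → subst (λ C → m ∈ lab x i C) (∈-satisfying⁻ (λ m → labelBlock i m ≟ B) m∈)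
                        (∈-lab-labelBlock i m))
      (λ m∈ → ∈-satisfying⁺ (λ m → labelBlock i m ≟ B) (labelBlock-unique bB m∈))
  ... | no ¬bB = cong ∣_∣ (⊆-antisym
    (λ {m} m∈ → contradiction (subst (Block P) (∈-satisfying⁻ (λ m → labelBlock i m ≟ B) m∈)
                                       (labelBlock-isBlock i m)) ¬bB)
    (λ {m} m∈ → contradiction (subst (Block P) (∈-satisfying⁻ (λ m → blockOf P m ≟ B) m∈)
                                       (blockOf-isBlock P m)) ¬bB))

  LabelledBy : VecPartition n s → Set
  LabelledBy z = ∀ i C → Block (part z) C → ∀ m → m ∈ lab z i C ⇔ labelBlock i m ⊆ C

  labelledBy-self : LabelledBy x
  labelledBy-self i B bB m = mk⇔ to from
    where
    to : m ∈ lab x i B → labelBlock i m ⊆ B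
    to m∈ = subst (_⊆ B) (sym (labelBlock-unique bB m∈)) ⊆-refl
    from : labelBlock i m ⊆ B → m ∈ lab x i B
    from L⊆B = subst (λ C → m ∈ lab x i C)
      (blocks-above-unique {P = P} {R = P} (labelBlock-isBlock i m) (labelBlock-isBlock i m) bB
                           ⊆-refl L⊆B)
      (∈-lab-labelBlock i m)

  ≤V⇒labelledBy : ∀ z → x ≤V z → LabelledBy z
  ≤V⇒labelledBy z (_ , x≤z) i C bC m = mk⇔ to from
    where
    to : m ∈ lab z i C → labelBlock i m ⊆ C
    to m∈ with Equivalence.to (x≤z i C bC m) m∈
    ... | B , bB , B⊆C , m∈B = subst (_⊆ C) (sym (labelBlock-unique bB m∈B)) B⊆C
    from : labelBlock i m ⊆ C → m ∈ lab z i C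
    from L⊆C = Equivalence.from (x≤z i C bC m)
                 (labelBlock i m , labelBlock-isBlock i m , L⊆C , ∈-lab-labelBlock i m)

  labelledBy⇒≤V : ∀ z z' → P ≤P part z → LabelledBy z → LabelledBy z' →
                  part z ≤P part z' → z ≤V z'
  labelledBy⇒≤V z z' P≤z lz lz' z≤z' =
    z≤z' , λ i C' bC' m → mk⇔ (to i C' bC' m) (from i C' bC' m)
    where
    to : ∀ i C' → Block (part z') C' → ∀ m → m ∈ lab z' i C' →
         ∃[ C ] (Block (part z) C × C ⊆ C' × m ∈ lab z i C)
    to i C' bC' m m∈ with block-above {P = P} {R = part z} P≤z (labelBlock-isBlock i m)
                        | nonempty P (labelBlock i m) (labelBlock-isBlock i m)
    ... | C , bC , L⊆C | e , e∈L =
      C , bC ,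
      meeting-block-⊆ {P = part z} {R = part z'} z≤z' bC bC' (L⊆C e∈L)
                      (Equivalence.to (lz' i C' bC' m) m∈ e∈L) ,
      Equivalence.from (lz i C bC m) L⊆C
    from : ∀ i C' → Block (part z') C' → ∀ m →
           ∃[ C ] (Block (part z) C × C ⊆ C' × m ∈ lab z i C) → m ∈ lab z' i C'
    from i C' bC' m (C , bC , C⊆C' , m∈) =
      Equivalence.from (lz' i C' bC' m) (⊆-trans (Equivalence.to (lz i C bC m) m∈) C⊆C')

  labelledBy-lab-unique : ∀ z z' → LabelledBy z → LabelledBy z' → part z ≈P part z' →
                          ∀ i C → Block (part z) C → lab z i C ≡ lab z' i C
  labelledBy-lab-unique z z' lz lz' z≈z' i C bC = ⊆-antisym
    (λ {m} m∈ → Equivalence.from (lz' i C bC' m) (Equivalence.to (lz i C bC m) m∈))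
    (λ {m} m∈ → Equivalence.from (lz i C bC m) (Equivalence.to (lz' i C bC' m) m∈))
    where bC' = trans (sym (z≈z' C)) bC

  module _ (R : Partition n) (P≤R : P ≤P R) where

    inducedLab : Fin s → Subset n → Subset n
    inducedLab i C = preimage (labelBlock i) (_⊆? C)

    withInducedLabels : VecPartition n s
    withInducedLabels = record
      { part         = R
      ; lab          = inducedLab
      ; lab-size     = λ i C bC →
          trans (∣preimage∣-cong-fibres (labelBlock i) (blockOf P) (∣fibre-labelBlock∣ i) (_⊆? C))
                (cong ∣_∣ (preimage-blockOf-⊆ {P = P} {R = R} P≤R bC))
      ; lab-cover    = λ i m →
          let (C , bC , L⊆C) = block-above {P = P} {R = R} P≤R (labelBlock-isBlock i m)
          in C , bC , ∈-satisfying⁺ (λ m → labelBlock i m ⊆? C) L⊆C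
      ; lab-disjoint = λ i C D bC bD m m∈C m∈D →
          blocks-above-unique {P = P} {R = R} (labelBlock-isBlock i m) bC bD
            (∈-satisfying⁻ (λ m → labelBlock i m ⊆? C) m∈C)
            (∈-satisfying⁻ (λ m → labelBlock i m ⊆? D) m∈D)
      }

    withInducedLabels-labelledBy : LabelledBy withInducedLabels
    withInducedLabels-labelledBy i C _ m =
      mk⇔ (∈-satisfying⁻ (λ m → labelBlock i m ⊆? C)) (∈-satisfying⁺ (λ m → labelBlock i m ⊆? C))

proposition3p3 : ∀ n s → 1 ≤ n → 1 ≤ s → (x y : VecPartition n s) →
    just x ≤Π just y →
    IsOrderIso {IntervalΠ (just x) (just y)} {IntervalP (part x) (part y)}
      (_≈IΠ_ {n} {s} {just x} {just y})
      (_≤IΠ_ {n} {s} {just x} {just y})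
      (_≈IP_ {n} {part x} {part y}) (_≤IP_ {n} {part x} {part y}) (forget x y)
proposition3p3 n s _ _ x y x≤y = record
  { cong       = λ { (nothing , () , _) _
                   ; (just _ , _) (nothing , () , _)
                   ; (just _ , _) (just _ , _) → proj₁ }
  ; injective  = injective
  ; surjective = λ (R , P≤R , R≤Q) →
      (just (withInducedLabels R P≤R) , x≤withInducedLabels R P≤R , withInducedLabels≤y R P≤R R≤Q) ,
      λ _ → refl
  ; order      = order
  }
  where
  open InducedLabels x

  x≤withInducedLabels : ∀ R P≤R → x ≤V withInducedLabels R P≤R
  x≤withInducedLabels R P≤R =
    labelledBy⇒≤V x (withInducedLabels R P≤R) (≤P-refl {P = part x})
                  labelledBy-self (withInducedLabels-labelledBy R P≤R) P≤R

  withInducedLabels≤y : ∀ R P≤R → R ≤P part y → withInducedLabels R P≤R ≤V y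
  withInducedLabels≤y R P≤R R≤Q =
    labelledBy⇒≤V (withInducedLabels R P≤R) y P≤R
                  (withInducedLabels-labelledBy R P≤R) (≤V⇒labelledBy y x≤y) R≤Q

  injective : (u v : IntervalΠ (just x) (just y)) →
              proj₁ (forget x y u) ≈P proj₁ (forget x y v) → proj₁ u ≈Π proj₁ v
  injective (nothing , () , _) _
  injective (just _ , _) (nothing , () , _)
  injective (just z , x≤z , _) (just z' , x≤z' , _) z≈z' =
    z≈z' , labelledBy-lab-unique z z' (≤V⇒labelledBy z x≤z) (≤V⇒labelledBy z' x≤z') z≈z'

  order : (u v : IntervalΠ (just x) (just y)) →
          proj₁ u ≤Π proj₁ v ⇔ proj₁ (forget x y u) ≤P proj₁ (forget x y v)
  order (nothing , () , _) _
  order (just _ , _) (nothing , () , _)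
  order (just z , x≤z , _) (just z' , x≤z' , _) =
    mk⇔ proj₁ (labelledBy⇒≤V z z' (proj₁ x≤z) (≤V⇒labelledBy z x≤z) (≤V⇒labelledBy z' x≤z'))
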